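{- Let $p$ be a prime, $r$ a natural number, and $s=\lfloor (r-1)/2\rfloor$. Then $$|S(p^r)^*|=\sum_{k=0}^{s}\big|\,p^{2k}U(p^r)^2\big|=\sum_{k=0}^{s}\big|\,U(p^{r-2k})^2\big|.$$ Consequently, if $r$ is even then $|S(p^r)^*|=\sum_{l=1}^{r/2}|U(p^{2l})^2|$, and if $r$ is odd then $|S(p^r)^*|=\sum_{l=0}^{(r-1)/2}|U(p^{2l+1})^2|$.
   Context: For a natural number $m$, $\mathbb Z_m=\mathbb Z/m\mathbb Z$, $U(m)$ is the group of units of $\mathbb Z_m$, and $U(m)^2=\{x^2: x\in U(m)\}$. $S(m)=\{x^2:x\in\mathbb Z_m\}$ and $S(m)^*=S(m)\setminus\{0\}$. For $a\in\mathbb Z_m$, $aU(m)^2=\{au:u\in U(m)^2\}$. -}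

module Defs where

open import Data.Nat using (ℕ; zero; suc; _+_; _*_; _∸_; _^_; ∣_-_∣)
open import Data.Nat.Properties using (_≟_)
open import Data.Nat.Divisibility using (_∣_; _∣?_)
open import Data.Fin using (Fin; toℕ)
open import Data.Fin.Properties using (any?)
open import Data.List using (List; length; filter; map; upTo)
open import Data.Nat.ListAction using (sum)
import Agda.Primitive
open import Data.List.Base using (allFin)
open import Data.Product using (Σ; ∃; _×_; _,_)
open import Relation.Nullary using (¬_; Dec)
open import Relation.Nullary.Decidable using (_×-dec_; ¬?)
open import Relation.Unary using (Pred; Decidable)

_≡[mod_]_ : ℕ → ℕ → ℕ → Set
a ≡[mod m ] b = m ∣ ∣ a - b ∣

_≡[mod_]?_ : ∀ a m b → Dec (a ≡[mod m ] b)
a ≡[mod m ]? b = m ∣? ∣ a - b ∣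

-- Elements of ℤ_m are represented by Fin m (i.e. 0,…,m-1).

card : (m : ℕ) {P : Pred (Fin m) Agda.Primitive.lzero} → Decidable P → ℕ
card m P? = length (filter P? (allFin m))

IsUnit : (m : ℕ) → Fin m → Set
IsUnit m x = ∃ λ (v : Fin m) → (toℕ x * toℕ v) ≡[mod m ] 1

isUnit? : (m : ℕ) → Decidable (IsUnit m)
isUnit? m x = any? (λ v → (toℕ x * toℕ v) ≡[mod m ]? 1)

InU² : (m : ℕ) → Fin m → Set
InU² m y = ∃ λ (x : Fin m) → IsUnit m x × ((toℕ x * toℕ x) ≡[mod m ] toℕ y)

inU²? : (m : ℕ) → Decidable (InU² m)
inU²? m y = any? (λ x → isUnit? m x ×-dec ((toℕ x * toℕ x) ≡[mod m ]? toℕ y))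

InAU² : (m a : ℕ) → Fin m → Set
InAU² m a y = ∃ λ (u : Fin m) → InU² m u × ((a * toℕ u) ≡[mod m ] toℕ y)

inAU²? : (m a : ℕ) → Decidable (InAU² m a)
inAU²? m a y = any? (λ u → inU²? m u ×-dec ((a * toℕ u) ≡[mod m ]? toℕ y))

InS* : (m : ℕ) → Fin m → Set
InS* m y = (¬ (toℕ y ≡[mod m ] 0)) × (∃ λ (x : Fin m) → (toℕ x * toℕ x) ≡[mod m ] toℕ y)

inS*? : (m : ℕ) → Decidable (InS* m)
inS*? m y = ¬? (toℕ y ≡[mod m ]? 0) ×-dec any? (λ x → (toℕ x * toℕ x) ≡[mod m ]? toℕ y)

∣S*∣ : ℕ → ℕ
∣S*∣ m = card m (inS*? m)

∣U²∣ : ℕ → ℕ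
∣U²∣ m = card m (inU²? m)

∣aU²∣ : ℕ → ℕ → ℕ
∣aU²∣ a m = card m (inAU²? m a)

∑≤ : ℕ → (ℕ → ℕ) → ℕ
∑≤ n f = sum (map f (upTo (suc n)))

∑from-to : ℕ → ℕ → (ℕ → ℕ) → ℕ
∑from-to a b f = sum (map (λ i → f (a + i)) (upTo (suc b ∸ a)))

-- A nonzero square modulo p ^ r is (p ^ k * w) ^ 2 with p ∤ w, and p ^ (2k) w² has exact p-adic
-- valuation 2k < r, which a congruence modulo p ^ r preserves; so S(p^r)* is the disjoint union of
-- the classes p^(2k) U(p^r)² for 2k < r. Writing y = p^j z, membership of y in p^j U(p^r)² is
-- membership of z in U(p^(r-j))², and that class contains no non-multiples of p^j, so it has
-- |U(p^(r-j))²| elements.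

module Submission where

open import Algebra.Properties.CommutativeSemigroup using (interchange)
open import Data.Empty using (⊥-elim)
open import Data.Fin.Base using (Fin; toℕ)
open import Data.Fin.Properties using (any?; toℕ-fromℕ<)
open import Data.List.Base using ([]; _∷_; length; filter; map; upTo; applyUpTo; tabulate; allFin)
open import Data.List.Properties using (map-upTo; map-tabulate)
open import Data.Nat.Base
open import Data.Nat.Properties
open import Data.Nat.ListAction using (sum)
open import Data.Nat.DivMod
open import Data.Nat.Divisibility
open import Data.Nat.Coprimality using (Coprime; coprime-divisor; coprime-Bézout)
open import Data.Nat.GCD using (module Bézout)
open import Data.Nat.Induction using (<-rec)
open import Data.Nat.Tactic.RingSolver using (solve-∀)
open import Data.Nat.Primality using (Prime; euclidsLemma; prime⇒nonZero; prime⇒irreducible; prime⇒nonTrivial)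
open import Data.Product using (_×_; _,_; ∃; ∃₂)
open import Data.Sum using (inj₁; inj₂)
open import Function using (id; _∘_; _⇔_; mk⇔; Equivalence)
open import Function.Properties.Equivalence using () renaming (trans to ⇔-trans; sym to ⇔-sym)
open import Relation.Binary.Definitions using (tri<; tri≈; tri>)
open import Relation.Binary.PropositionalEquality
open import Relation.Nullary using (¬_; Dec; yes; no; contradiction)
open import Relation.Nullary.Decidable using (_×-dec_; ¬?)
open import Relation.Unary using (Pred; Decidable)
open import Level using (0ℓ)

open import Defs

∑< : (ℕ → ℕ) → ℕ → ℕ
∑< f n = sum (applyUpTo f n)

sum-map-upTo : ∀ f n → sum (map f (upTo n)) ≡ ∑< f n
sum-map-upTo f n = cong sum (map-upTo f n)

∑<-cong : ∀ {f g} n → (∀ i → i < n → f i ≡ g i) → ∑< f n ≡ ∑< g n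
∑<-cong zero    f≡g = refl
∑<-cong (suc n) f≡g = cong₂ _+_ (f≡g 0 z<s) (∑<-cong n (λ i i<n → f≡g (suc i) (s<s i<n)))

∑<-zero : ∀ {f} n → (∀ i → i < n → f i ≡ 0) → ∑< f n ≡ 0
∑<-zero zero    f≡0 = refl
∑<-zero (suc n) f≡0 = cong₂ _+_ (f≡0 0 z<s) (∑<-zero n (λ i i<n → f≡0 (suc i) (s<s i<n)))

∑<-distrib-+ : ∀ f g n → ∑< (λ i → f i + g i) n ≡ ∑< f n + ∑< g n
∑<-distrib-+ f g zero    = refl
∑<-distrib-+ f g (suc n) = begin
  f 0 + g 0 + ∑< (λ i → f (suc i) + g (suc i)) n
    ≡⟨ cong (f 0 + g 0 +_) (∑<-distrib-+ (f ∘ suc) (g ∘ suc) n) ⟩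
  (f 0 + g 0) + (∑< (f ∘ suc) n + ∑< (g ∘ suc) n)
    ≡⟨ interchange +-commutativeSemigroup (f 0) (g 0) _ _ ⟩
  (f 0 + ∑< (f ∘ suc) n) + (g 0 + ∑< (g ∘ suc) n)
    ∎
  where open ≡-Reasoning

∑<-comm : ∀ (F : ℕ → ℕ → ℕ) m n →
          ∑< (λ i → ∑< (F i) n) m ≡ ∑< (λ j → ∑< (λ i → F i j) m) n
∑<-comm F zero    n = sym (∑<-zero n (λ _ _ → refl))
∑<-comm F (suc m) n = begin
  ∑< (F 0) n + ∑< (λ i → ∑< (F (suc i)) n) m
    ≡⟨ cong (∑< (F 0) n +_) (∑<-comm (F ∘ suc) m n) ⟩
  ∑< (F 0) n + ∑< (λ j → ∑< (λ i → F (suc i) j) m) n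
    ≡⟨ ∑<-distrib-+ (F 0) (λ j → ∑< (λ i → F (suc i) j) m) n ⟨
  ∑< (λ j → ∑< (λ i → F i j) (suc m)) n
    ∎
  where open ≡-Reasoning

∑<-suc : ∀ f n → ∑< f (suc n) ≡ ∑< f n + f n
∑<-suc f zero    = +-comm (f 0) 0
∑<-suc f (suc n) = trans (cong (f 0 +_) (∑<-suc (f ∘ suc) n)) (sym (+-assoc (f 0) _ _))

∑<-+ : ∀ f m n → ∑< f (m + n) ≡ ∑< f m + ∑< (λ i → f (m + i)) n
∑<-+ f zero    n = refl
∑<-+ f (suc m) n = trans (cong (f 0 +_) (∑<-+ (f ∘ suc) m n)) (sym (+-assoc (f 0) _ _))

∑<-reverse : ∀ f n → ∑< f n ≡ ∑< (λ i → f (n ∸ suc i)) n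
∑<-reverse f zero    = refl
∑<-reverse f (suc n) = begin
  ∑< f (suc n)                       ≡⟨ ∑<-suc f n ⟩
  ∑< f n + f n                       ≡⟨ cong (_+ f n) (∑<-reverse f n) ⟩
  ∑< (λ i → f (n ∸ suc i)) n + f n   ≡⟨ +-comm _ (f n) ⟩
  f n + ∑< (λ i → f (n ∸ suc i)) n   ∎
  where open ≡-Reasoning

∑<-multiples : ∀ a .{{_ : NonZero a}} f n → (∀ y → ¬ a ∣ y → f y ≡ 0) →
               ∑< f (a * n) ≡ ∑< (λ z → f (a * z)) n
∑<-multiples a f zero    f≡0 = cong (∑< f) (*-zeroʳ a)
∑<-multiples a@(suc a-1) f (suc n) f≡0 = begin
  ∑< f (a * suc n)                                 ≡⟨ cong (∑< f) (trans (*-suc a n) (+-comm a (a * n))) ⟩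
  ∑< f (a * n + a)                                 ≡⟨ ∑<-+ f (a * n) a ⟩
  ∑< f (a * n) + ∑< (λ i → f (a * n + i)) a        ≡⟨ cong₂ _+_ (∑<-multiples a f n f≡0) block ⟩
  ∑< (λ z → f (a * z)) n + f (a * n)               ≡⟨ ∑<-suc (λ z → f (a * z)) n ⟨
  ∑< (λ z → f (a * z)) (suc n)                     ∎
  where
  open ≡-Reasoning
  a∤an+1+i : ∀ i → suc i < a → ¬ a ∣ a * n + suc i
  a∤an+1+i i 1+i<a a∣an+1+i = <⇒≱ 1+i<a (∣⇒≤ (∣m+n∣m⇒∣n a∣an+1+i (m∣m*n n)))
  block : ∑< (λ i → f (a * n + i)) a ≡ f (a * n)
  block = trans (cong₂ _+_ (cong f (+-identityʳ (a * n)))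
                          (∑<-zero a-1 (λ i i<a-1 → f≡0 _ (a∤an+1+i i (s<s i<a-1)))))
                (+-identityʳ (f (a * n)))

iverson : ∀ {p} {P : Set p} → Dec P → ℕ
iverson (yes _) = 1
iverson (no  _) = 0

iverson-yes : ∀ {p} {P : Set p} (P? : Dec P) → P → iverson P? ≡ 1
iverson-yes (yes _) _  = refl
iverson-yes (no ¬p) p = contradiction p ¬p

iverson-no : ∀ {p} {P : Set p} (P? : Dec P) → ¬ P → iverson P? ≡ 0
iverson-no (yes p) ¬p = contradiction p ¬p
iverson-no (no _)  _  = refl

iverson-cong : ∀ {p q} {P : Set p} {Q : Set q} (P? : Dec P) (Q? : Dec Q) → P ⇔ Q →
               iverson P? ≡ iverson Q?
iverson-cong (yes _) (yes _) _   = refl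
iverson-cong (yes p) (no ¬q) P⇔Q = contradiction (Equivalence.to P⇔Q p) ¬q
iverson-cong (no ¬p) (yes q) P⇔Q = contradiction (Equivalence.from P⇔Q q) ¬p
iverson-cong (no _)  (no _)  _   = refl

∑<-iverson-unique : ∀ {p} {P : ℕ → Set p} (P? : ∀ k → Dec (P k)) n k₀ → k₀ < n → P k₀ →
                    (∀ k → k < n → P k → k ≡ k₀) → ∑< (λ k → iverson (P? k)) n ≡ 1
∑<-iverson-unique P? (suc n) zero _ P0 unique =
  cong₂ _+_ (iverson-yes (P? 0) P0)
    (∑<-zero n (λ k k<n → iverson-no (P? (suc k)) (λ Pk → 1+n≢0 (unique (suc k) (s<s k<n) Pk))))
∑<-iverson-unique P? (suc n) (suc k₀) (s<s k₀<n) Pk₀ unique =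
  cong₂ _+_ (iverson-no (P? 0) (λ P0 → 1+n≢0 (sym (unique 0 z<s P0))))
    (∑<-iverson-unique (P? ∘ suc) n k₀ k₀<n Pk₀
      (λ k k<n Pk → suc-injective (unique (suc k) (s<s k<n) Pk)))

length-filter : ∀ {a p} {A : Set a} {P : Pred A p} (P? : Decidable P) xs →
                length (filter P? xs) ≡ sum (map (iverson ∘ P?) xs)
length-filter P? []       = refl
length-filter P? (x ∷ xs) with P? x
... | yes _ = cong suc (length-filter P? xs)
... | no  _ = length-filter P? xs

tabulate-toℕ : ∀ {a} {A : Set a} (f : ℕ → A) n → tabulate {n = n} (f ∘ toℕ) ≡ applyUpTo f n
tabulate-toℕ f zero    = refl
tabulate-toℕ f (suc n) = cong (f 0 ∷_) (tabulate-toℕ (f ∘ suc) n)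

card-toℕ : ∀ m {Q : Pred ℕ 0ℓ} (Q? : Decidable Q) →
           card m (λ x → Q? (toℕ x)) ≡ ∑< (λ y → iverson (Q? y)) m
card-toℕ m Q? = begin
  length (filter (Q? ∘ toℕ) (allFin m))        ≡⟨ length-filter (Q? ∘ toℕ) (allFin m) ⟩
  sum (map (iverson ∘ Q? ∘ toℕ) (allFin m))
    ≡⟨ cong sum (map-tabulate {n = m} id (iverson ∘ Q? ∘ toℕ)) ⟩
  sum (tabulate {n = m} (iverson ∘ Q? ∘ toℕ))  ≡⟨ cong sum (tabulate-toℕ (iverson ∘ Q?) m) ⟩
  ∑< (iverson ∘ Q?) m                          ∎
  where open ≡-Reasoning

-- Wrapping _≡[mod_]_ in a record keeps a and b inferable: m ∣ ∣ a - b ∣ forgets them.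
infix 4 _≈_[mod_]
record _≈_[mod_] (a b m : ℕ) : Set where
  constructor ≡[mod]⇒≈
  field ≈⇒≡[mod] : a ≡[mod m ] b
open _≈_[mod_] public

≈-reflexive : ∀ {m a b} → a ≡ b → a ≈ b [mod m ]
≈-reflexive {m} a≡b = ≡[mod]⇒≈ (subst (m ∣_) (sym (m≡n⇒∣m-n∣≡0 a≡b)) (m ∣0))

≈-refl : ∀ {m a} → a ≈ a [mod m ]
≈-refl = ≈-reflexive refl

≈-sym : ∀ {m a b} → a ≈ b [mod m ] → b ≈ a [mod m ]
≈-sym {m} {a} {b} (≡[mod]⇒≈ m∣∣a-b∣) = ≡[mod]⇒≈ (subst (m ∣_) (∣-∣-comm a b) m∣∣a-b∣)

private
  module _ {m : ℕ} .{{_ : NonZero m}} where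

    ∣∸⇒%≡ : ∀ {a b} → a ≤ b → m ∣ b ∸ a → a % m ≡ b % m
    ∣∸⇒%≡ {a} a≤b m∣b∸a = sym (trans (cong (_% m) (sym (m+[n∸m]≡n a≤b))) (%-remove-+ʳ a m∣b∸a))

    %≡⇒∣∸ : ∀ {a b} → a ≤ b → a % m ≡ b % m → m ∣ b ∸ a
    %≡⇒∣∸ {a} {b} _ a%m≡b%m = divides (b / m ∸ a / m) (begin
      b ∸ a                                     ≡⟨ cong₂ _∸_ (m≡m%n+[m/n]*n b m) (m≡m%n+[m/n]*n a m) ⟩
      (b % m + b / m * m) ∸ (a % m + a / m * m) ≡⟨ cong (λ x → (x + b / m * m) ∸ (a % m + a / m * m)) a%m≡b%m ⟨
      (a % m + b / m * m) ∸ (a % m + a / m * m) ≡⟨ [m+n]∸[m+o]≡n∸o (a % m) _ _ ⟩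
      b / m * m ∸ a / m * m                     ≡⟨ *-distribʳ-∸ m (b / m) (a / m) ⟨
      (b / m ∸ a / m) * m                       ∎)
      where open ≡-Reasoning

    ≈⇒%≡ : ∀ {a b} → a ≈ b [mod m ] → a % m ≡ b % m
    ≈⇒%≡ {a} {b} (≡[mod]⇒≈ m∣∣a-b∣) with ≤-total a b
    ... | inj₁ a≤b = ∣∸⇒%≡ a≤b (subst (m ∣_) (m≤n⇒∣m-n∣≡n∸m a≤b) m∣∣a-b∣)
    ... | inj₂ b≤a = sym (∣∸⇒%≡ b≤a (subst (m ∣_) (m≤n⇒∣n-m∣≡n∸m b≤a) m∣∣a-b∣))

    %≡⇒≈ : ∀ {a b} → a % m ≡ b % m → a ≈ b [mod m ]
    %≡⇒≈ {a} {b} a%m≡b%m with ≤-total a b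
    ... | inj₁ a≤b = ≡[mod]⇒≈ (subst (m ∣_) (sym (m≤n⇒∣m-n∣≡n∸m a≤b)) (%≡⇒∣∸ a≤b a%m≡b%m))
    ... | inj₂ b≤a = ≡[mod]⇒≈ (subst (m ∣_) (sym (m≤n⇒∣n-m∣≡n∸m b≤a)) (%≡⇒∣∸ b≤a (sym a%m≡b%m)))

≈-trans : ∀ {m a b c} → a ≈ b [mod m ] → b ≈ c [mod m ] → a ≈ c [mod m ]
≈-trans {zero} (≡[mod]⇒≈ 0∣∣a-b∣) b≈c =
  subst (λ x → x ≈ _ [mod 0 ]) (sym (∣m-n∣≡0⇒m≡n (0∣⇒≡0 0∣∣a-b∣))) b≈c
≈-trans {suc _} a≈b b≈c = %≡⇒≈ (trans (≈⇒%≡ a≈b) (≈⇒%≡ b≈c))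

*-congʳ-≈ : ∀ {m a b} c → a ≈ b [mod m ] → a * c ≈ b * c [mod m ]
*-congʳ-≈ {m} {a} {b} c (≡[mod]⇒≈ m∣∣a-b∣) =
  ≡[mod]⇒≈ (subst (m ∣_) (*-distribʳ-∣-∣ c a b) (∣m⇒∣m*n c m∣∣a-b∣))

*-cong-≈ : ∀ {m a b c d} → a ≈ b [mod m ] → c ≈ d [mod m ] → a * c ≈ b * d [mod m ]
*-cong-≈ {m} {a} {b} {c} {d} a≈b c≈d = ≈-trans (*-congʳ-≈ c a≈b)
  (subst₂ (λ x y → x ≈ y [mod m ]) (*-comm c b) (*-comm d b) (*-congʳ-≈ b c≈d))

+-cancelˡ-≈ : ∀ {m} c {a b} → c + a ≈ c + b [mod m ] → a ≈ b [mod m ]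
+-cancelˡ-≈ {m} c {a} {b} (≡[mod]⇒≈ m∣∣c+a-c+b∣) =
  ≡[mod]⇒≈ (subst (m ∣_) (∣m+n-m+o∣≡∣n-o∣ c a b) m∣∣c+a-c+b∣)

+-*-≈ : ∀ {m} a q → a + q * m ≈ a [mod m ]
+-*-≈ {m} a q = ≡[mod]⇒≈ (subst (m ∣_) (trans (sym (∣m-m+n∣≡n a (q * m))) (∣-∣-comm a _)) (n∣m*n q))

∣⇒≈0 : ∀ {m a} → m ∣ a → a ≈ 0 [mod m ]
∣⇒≈0 {m} {a} m∣a = ≡[mod]⇒≈ (subst (m ∣_) (sym (∣-∣-identityʳ a)) m∣a)

≈-resp-∣ : ∀ {d a b} → a ≈ b [mod d ] → d ∣ a → d ∣ b
≈-resp-∣ {d} {a} {b} (≡[mod]⇒≈ d∣∣a-b∣) d∣a with ≤-total a b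
... | inj₁ a≤b = ∣m∸n∣n⇒∣m d a≤b (subst (d ∣_) (m≤n⇒∣m-n∣≡n∸m a≤b) d∣∣a-b∣) d∣a
... | inj₂ b≤a = ∣m+n∣m⇒∣n (subst (d ∣_) (sym (m∸n+n≡m b≤a)) d∣a)
                           (subst (d ∣_) (m≤n⇒∣n-m∣≡n∸m b≤a) d∣∣a-b∣)

≈-weaken : ∀ {d m a b} → d ∣ m → a ≈ b [mod m ] → a ≈ b [mod d ]
≈-weaken d∣m (≡[mod]⇒≈ m∣∣a-b∣) = ≡[mod]⇒≈ (∣-trans d∣m m∣∣a-b∣)

*-monoˡ-≈ : ∀ k {m a b} → a ≈ b [mod m ] → k * a ≈ k * b [mod k * m ]
*-monoˡ-≈ k {m} {a} {b} (≡[mod]⇒≈ m∣∣a-b∣) =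
  ≡[mod]⇒≈ (subst (k * m ∣_) (*-distribˡ-∣-∣ k a b) (*-monoʳ-∣ k m∣∣a-b∣))

*-cancelˡ-≈ : ∀ k .{{_ : NonZero k}} {m a b} → k * a ≈ k * b [mod k * m ] → a ≈ b [mod m ]
*-cancelˡ-≈ k {m} {a} {b} (≡[mod]⇒≈ km∣∣ka-kb∣) =
  ≡[mod]⇒≈ (*-cancelˡ-∣ k (subst (k * m ∣_) (sym (*-distribˡ-∣-∣ k a b)) km∣∣ka-kb∣))

mod-≈ : ∀ m .{{_ : NonZero m}} a → toℕ (a mod m) ≈ a [mod m ]
mod-≈ m a = ≡[mod]⇒≈ (subst (m ∣_) a/m*m≡∣a%m-a∣ (n∣m*n (a / m)))
  where
  a/m*m≡∣a%m-a∣ : a / m * m ≡ ∣ toℕ (a mod m) - a ∣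
  a/m*m≡∣a%m-a∣ = begin
    a / m * m                       ≡⟨ ∣m-m+n∣≡n (a % m) (a / m * m) ⟨
    ∣ a % m - a % m + a / m * m ∣   ≡⟨ cong ∣ a % m -_∣ (m≡m%n+[m/n]*n a m) ⟨
    ∣ a % m - a ∣                   ≡⟨ cong ∣_- a ∣ (toℕ-fromℕ< (m%n<n a m)) ⟨
    ∣ toℕ (a mod m) - a ∣           ∎
    where open ≡-Reasoning

unit⇒coprime : ∀ {m x v} → x * v ≈ 1 [mod m ] → Coprime x m
unit⇒coprime {v = v} xv≈1 (d∣x , d∣m) = ∣1⇒≡1 (≈-resp-∣ (≈-weaken d∣m xv≈1) (∣m⇒∣m*n v d∣x))

coprime⇒unit : ∀ {m x} .{{_ : NonZero m}} → Coprime x m → ∃ λ v → x * v ≈ 1 [mod m ]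
coprime⇒unit {m} {x} x⊥m with coprime-Bézout x⊥m
... | Bézout.+- v y 1+ym≡vx =
  v , ≈-trans (≈-reflexive (trans (*-comm x v) (sym 1+ym≡vx))) (+-*-≈ 1 y)
... | Bézout.-+ v y 1+vx≡ym = v * pred m , +-cancelˡ-≈ (v * x) (≈-trans vx+xv′≈0 (≈-sym vx+1≈0))
  where
  vx+xv′≈0 : v * x + x * (v * pred m) ≈ 0 [mod m ]
  vx+xv′≈0 = ∣⇒≈0 (subst (m ∣_) (sym (trans (expand v x (pred m)) (cong (v * x *_) (suc-pred m))))
                               (n∣m*n (v * x)))
    where
    expand : ∀ v x k → v * x + x * (v * k) ≡ v * x * suc k
    expand = solve-∀
  vx+1≈0 : v * x + 1 ≈ 0 [mod m ]
  vx+1≈0 = ∣⇒≈0 (subst (m ∣_) (trans (sym 1+vx≡ym) (+-comm 1 (v * x))) (n∣m*n y))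

InS*′ : ℕ → ℕ → Set
InS*′ m y = (¬ (y ≡[mod m ] 0)) × (∃ λ (x : Fin m) → (toℕ x * toℕ x) ≡[mod m ] y)

inS*?′ : ∀ m → Decidable (InS*′ m)
inS*?′ m y = ¬? (y ≡[mod m ]? 0) ×-dec any? (λ x → (toℕ x * toℕ x) ≡[mod m ]? y)

InU²′ : ℕ → ℕ → Set
InU²′ m y = ∃ λ (x : Fin m) → IsUnit m x × ((toℕ x * toℕ x) ≡[mod m ] y)

inU²?′ : ∀ m → Decidable (InU²′ m)
inU²?′ m y = any? (λ x → isUnit? m x ×-dec ((toℕ x * toℕ x) ≡[mod m ]? y))

InAU²′ : ℕ → ℕ → ℕ → Set
InAU²′ m a y = ∃ λ (u : Fin m) → InU² m u × ((a * toℕ u) ≡[mod m ] y)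

inAU²?′ : ∀ m a → Decidable (InAU²′ m a)
inAU²?′ m a y = any? (λ u → inU²? m u ×-dec ((a * toℕ u) ≡[mod m ]? y))

∣S*∣≡∑< : ∀ m → ∣S*∣ m ≡ ∑< (λ y → iverson (inS*?′ m y)) m
∣S*∣≡∑< m = card-toℕ m (inS*?′ m)

∣U²∣≡∑< : ∀ m → ∣U²∣ m ≡ ∑< (λ y → iverson (inU²?′ m y)) m
∣U²∣≡∑< m = card-toℕ m (inU²?′ m)

∣aU²∣≡∑< : ∀ a m → ∣aU²∣ a m ≡ ∑< (λ y → iverson (inAU²?′ m a y)) m
∣aU²∣≡∑< a m = card-toℕ m (inAU²?′ m a)

2*t/2≡t : ∀ t → 2 * t / 2 ≡ t
2*t/2≡t t = trans (cong (_/ 2) (*-comm 2 t)) (m*n/n≡m t 2)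

[2*t+1]/2≡t : ∀ t → (2 * t + 1) / 2 ≡ t
[2*t+1]/2≡t t = trans (+-distrib-/-∣ˡ 1 (divides t (*-comm 2 t))) (trans (+-identityʳ _) (2*t/2≡t t))

2*k<r⇒k≤[r∸1]/2 : ∀ {k r} → 2 * k < r → k ≤ (r ∸ 1) / 2
2*k<r⇒k≤[r∸1]/2 {k} {r} 2k<r =
  subst (_≤ (r ∸ 1) / 2) (2*t/2≡t k) (/-mono-≤ (∸-monoˡ-≤ 1 2k<r) ≤-refl)

k≤[r∸1]/2⇒2*k<r : ∀ {k r} → 0 < r → k ≤ (r ∸ 1) / 2 → 2 * k < r
k≤[r∸1]/2⇒2*k<r {k} {r} 0<r k≤[r∸1]/2 = subst (2 * k <_) (m+[n∸m]≡n 0<r) (s≤s (begin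
  2 * k               ≤⟨ *-monoʳ-≤ 2 k≤[r∸1]/2 ⟩
  2 * ((r ∸ 1) / 2)   ≡⟨ *-comm 2 ((r ∸ 1) / 2) ⟩
  (r ∸ 1) / 2 * 2     ≤⟨ m/n*n≤m (r ∸ 1) 2 ⟩
  r ∸ 1               ∎))
  where open ≤-Reasoning

2*t∸2*[t∸j]≡2*j : ∀ {t j} → j ≤ t → 2 * t ∸ 2 * (t ∸ j) ≡ 2 * j
2*t∸2*[t∸j]≡2*j {t} {j} j≤t = trans (cong (2 * t ∸_) (*-distribˡ-∸ 2 t j)) (m∸[m∸n]≡n (*-monoʳ-≤ 2 j≤t))

module _ {p : ℕ} (p-prime : Prime p) where

  private
    instance
      p≢0 : NonZero p
      p≢0 = prime⇒nonZero p-prime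

    1<p : 1 < p
    1<p = nonTrivial⇒n>1 p {{prime⇒nonTrivial p-prime}}

  p^-mono-∣ : ∀ {i j} → i ≤ j → p ^ i ∣ p ^ j
  p^-mono-∣ {i} {j} i≤j = divides (p ^ (j ∸ i))
    (trans (cong (p ^_) (sym (m∸n+n≡m i≤j))) (^-distribˡ-+-* p (j ∸ i) i))

  p^-split : ∀ {i n} → i ≤ n → p ^ n ≡ p ^ i * p ^ (n ∸ i)
  p^-split {i} {n} i≤n = trans (cong (p ^_) (sym (m+[n∸m]≡n i≤n))) (^-distribˡ-+-* p i (n ∸ i))

  p^2k≡p^k*p^k : ∀ k → p ^ (2 * k) ≡ p ^ k * p ^ k
  p^2k≡p^k*p^k k = trans (cong (λ j → p ^ (k + j)) (+-identityʳ k)) (^-distribˡ-+-* p k k)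

  [p^k*w]²≡p^2k*w² : ∀ k w → (p ^ k * w) * (p ^ k * w) ≡ p ^ (2 * k) * (w * w)
  [p^k*w]²≡p^2k*w² k w = trans (interchange *-commutativeSemigroup (p ^ k) w (p ^ k) w)
                                (cong (_* (w * w)) (sym (p^2k≡p^k*p^k k)))

  ∤⇒∤² : ∀ {w} → ¬ p ∣ w → ¬ p ∣ w * w
  ∤⇒∤² p∤w p∣w² with euclidsLemma _ _ p-prime p∣w²
  ... | inj₁ p∣w = p∤w p∣w
  ... | inj₂ p∣w = p∤w p∣w

  p^[1+n]∤p^n* : ∀ n {v} → ¬ p ∣ v → ¬ p ^ suc n ∣ p ^ n * v
  p^[1+n]∤p^n* n {v} p∤v p^[1+n]∣p^n*v =
    p∤v (*-cancelˡ-∣ (p ^ n) {{m^n≢0 p n}} (subst (_∣ p ^ n * v) (*-comm p (p ^ n)) p^[1+n]∣p^n*v))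

  ∤⇒coprime-p^ : ∀ {w} → ¬ p ∣ w → ∀ n → Coprime w (p ^ n)
  ∤⇒coprime-p^ p∤w zero    (_ , d∣1)     = ∣1⇒≡1 d∣1
  ∤⇒coprime-p^ {w} p∤w (suc n) {d} (d∣w , d∣p^[1+n]) =
    ∤⇒coprime-p^ p∤w n (d∣w , coprime-divisor d⊥p d∣p^[1+n])
    where
    d⊥p : Coprime d p
    d⊥p (e∣d , e∣p) with prime⇒irreducible p-prime e∣p
    ... | inj₁ e≡1 = e≡1
    ... | inj₂ refl = ⊥-elim (p∤w (∣-trans e∣d d∣w))

  coprime-p^⇒∤ : ∀ {w n} → 0 < n → Coprime w (p ^ n) → ¬ p ∣ w
  coprime-p^⇒∤ {n = suc n} _ w⊥p^n p∣w =
    <⇒≢ 1<p (sym (w⊥p^n (p∣w , m∣m*n (p ^ n))))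

  factorise : ∀ x .{{_ : NonZero x}} → ∃₂ λ j w → x ≡ p ^ j * w × ¬ p ∣ w
  factorise = <-rec _ go
    where
    go : ∀ x → (∀ {y} → y < x → .{{_ : NonZero y}} → ∃₂ λ j w → y ≡ p ^ j * w × ¬ p ∣ w) →
         .{{_ : NonZero x}} → ∃₂ λ j w → x ≡ p ^ j * w × ¬ p ∣ w
    go x rec with p ∣? x
    ... | no p∤x = 0 , x , sym (*-identityˡ x) , p∤x
    ... | yes (divides zero x≡0) = contradiction x≡0 (≢-nonZero⁻¹ x)
    ... | yes (divides q@(suc _) x≡q*p) with rec (subst (q <_) (sym x≡q*p) (m<m*n q p 1<p))
    ...   | j , w , q≡p^j*w , p∤w = suc j , w , (begin
      x                 ≡⟨ x≡q*p ⟩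
      q * p             ≡⟨ cong (_* p) q≡p^j*w ⟩
      p ^ j * w * p     ≡⟨ *-comm (p ^ j * w) p ⟩
      p * (p ^ j * w)   ≡⟨ *-assoc p (p ^ j) w ⟨
      p * p ^ j * w     ∎) , p∤w
      where open ≡-Reasoning

  UnitSquare : ℕ → ℕ → Set
  UnitSquare n z = ∃ λ w → ¬ p ∣ w × w * w ≈ z [mod p ^ n ]

  UnitSquareMultiple : ℕ → ℕ → ℕ → Set
  UnitSquareMultiple n a y = ∃ λ w → ¬ p ∣ w × a * (w * w) ≈ y [mod p ^ n ]

  residue : ∀ n → ℕ → Fin (p ^ n)
  residue n w = (w mod p ^ n) {{m^n≢0 p n}}

  residue-≈ : ∀ n w → toℕ (residue n w) ≈ w [mod p ^ n ]
  residue-≈ n = mod-≈ (p ^ n) {{m^n≢0 p n}}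

  isUnit⇒∤ : ∀ {n} → 0 < n → (x : Fin (p ^ n)) → IsUnit (p ^ n) x → ¬ p ∣ toℕ x
  isUnit⇒∤ 0<n x (_ , xv≡1) = coprime-p^⇒∤ 0<n (unit⇒coprime (≡[mod]⇒≈ xv≡1))

  ∤⇒isUnit : ∀ n {w} → ¬ p ∣ w → IsUnit (p ^ n) (residue n w)
  ∤⇒isUnit n {w} p∤w with coprime⇒unit {{m^n≢0 p n}} (∤⇒coprime-p^ p∤w n)
  ... | v , wv≈1 = residue n v , ≈⇒≡[mod]
    (≈-trans (*-cong-≈ (residue-≈ n w) (residue-≈ n v)) wv≈1)

  inU²⇔unitSquare : ∀ {n z} → 0 < n → InU²′ (p ^ n) z ⇔ UnitSquare n z
  inU²⇔unitSquare {n} {z} 0<n = mk⇔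
    (λ (x , x-unit , x²≡z) → toℕ x , isUnit⇒∤ 0<n x x-unit , ≡[mod]⇒≈ x²≡z)
    (λ (w , p∤w , w²≈z) → residue n w , ∤⇒isUnit n p∤w ,
      ≈⇒≡[mod] (≈-trans (*-cong-≈ (residue-≈ n w) (residue-≈ n w)) w²≈z))

  inAU²⇔unitSquareMultiple : ∀ {n} a {y} → 0 < n → InAU²′ (p ^ n) a y ⇔ UnitSquareMultiple n a y
  inAU²⇔unitSquareMultiple {n} a {y} 0<n = mk⇔
    (λ (u , u∈U² , au≡y) → let w , p∤w , w²≈u = Equivalence.to (inU²⇔unitSquare 0<n) u∈U² in
      w , p∤w , ≈-trans (*-cong-≈ (≈-refl {a = a}) w²≈u) (≡[mod]⇒≈ au≡y))
    (λ (w , p∤w , aw²≈y) → residue n (w * w) ,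
      Equivalence.from (inU²⇔unitSquare 0<n) (w , p∤w , ≈-sym (residue-≈ n (w * w))) ,
      ≈⇒≡[mod] (≈-trans (*-cong-≈ (≈-refl {a = a}) (residue-≈ n (w * w))) aw²≈y))

  unitSquareMultiple-p^⇔ : ∀ {j n z} → j ≤ n →
                           UnitSquareMultiple n (p ^ j) (p ^ j * z) ⇔ UnitSquare (n ∸ j) z
  unitSquareMultiple-p^⇔ {j} {n} {z} j≤n = mk⇔
    (λ (w , p∤w , e) → w , p∤w ,
      *-cancelˡ-≈ (p ^ j) {{m^n≢0 p j}} (subst (λ m → _ ≈ _ [mod m ]) (p^-split j≤n) e))
    (λ (w , p∤w , e) → w , p∤w ,
      subst (λ m → _ ≈ _ [mod m ]) (sym (p^-split j≤n)) (*-monoˡ-≈ (p ^ j) e))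

  unitSquareMultiple-p^⇒∣ : ∀ {j n y} → j ≤ n → UnitSquareMultiple n (p ^ j) y → p ^ j ∣ y
  unitSquareMultiple-p^⇒∣ j≤n (w , _ , e) = ≈-resp-∣ (≈-weaken (p^-mono-∣ j≤n) e) (m∣m*n (w * w))

  ≈p^i*⇒p^[1+i]∤ : ∀ {i n v b} → i < n → ¬ p ∣ v → p ^ i * v ≈ b [mod p ^ n ] → ¬ p ^ suc i ∣ b
  ≈p^i*⇒p^[1+i]∤ {i} i<n p∤v e p^[1+i]∣b =
    p^[1+n]∤p^n* i p∤v (≈-resp-∣ (≈-sym (≈-weaken (p^-mono-∣ i<n) e)) p^[1+i]∣b)

  unitSquareMultiple⇒inS* : ∀ {k n y} → 2 * k < n → UnitSquareMultiple n (p ^ (2 * k)) y → InS*′ (p ^ n) y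
  unitSquareMultiple⇒inS* {k} {n} {y} 2k<n (w , p∤w , e) = y≉0 , residue n (p ^ k * w) , ≈⇒≡[mod] x²≈y
    where
    y≉0 : ¬ y ≡[mod p ^ n ] 0
    y≉0 y≡0 = ≈p^i*⇒p^[1+i]∤ 2k<n (∤⇒∤² p∤w) (≈-trans e (≡[mod]⇒≈ y≡0)) ((p ^ suc (2 * k)) ∣0)
    x²≈y : toℕ (residue n (p ^ k * w)) * toℕ (residue n (p ^ k * w)) ≈ y [mod p ^ n ]
    x²≈y = ≈-trans (*-cong-≈ (residue-≈ n _) (residue-≈ n _))
                   (≈-trans (≈-reflexive ([p^k*w]²≡p^2k*w² k w)) e)

  square⇒unitSquareMultiple : ∀ {n y} X → ¬ y ≈ 0 [mod p ^ n ] → X * X ≈ y [mod p ^ n ] →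
                              ∃ λ k → 2 * k < n × UnitSquareMultiple n (p ^ (2 * k)) y
  square⇒unitSquareMultiple zero y≉0 0≈y = contradiction (≈-sym 0≈y) y≉0
  square⇒unitSquareMultiple {n} {y} X@(suc _) y≉0 X²≈y with factorise X
  ... | j , w , X≡p^j*w , p∤w = decide (2 * j <? n)
    where
    p^2j*w²≈y : p ^ (2 * j) * (w * w) ≈ y [mod p ^ n ]
    p^2j*w²≈y = ≈-trans (≈-reflexive (trans (sym ([p^k*w]²≡p^2k*w² j w)) (cong (λ t → t * t) (sym X≡p^j*w))))
                        X²≈y
    decide : Dec (2 * j < n) → ∃ λ k → 2 * k < n × UnitSquareMultiple n (p ^ (2 * k)) y
    decide (yes 2j<n) = j , 2j<n , w , p∤w , p^2j*w²≈y
    decide (no 2j≮n)  = contradiction (∣⇒≈0 (≈-resp-∣ p^2j*w²≈y p^n∣p^2j*w²)) y≉0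
      where
      p^n∣p^2j*w² : p ^ n ∣ p ^ (2 * j) * (w * w)
      p^n∣p^2j*w² = ∣-trans (p^-mono-∣ (≮⇒≥ 2j≮n)) (m∣m*n (w * w))

  inS*⇒unitSquareMultiple : ∀ {n y} → InS*′ (p ^ n) y →
                            ∃ λ k → 2 * k < n × UnitSquareMultiple n (p ^ (2 * k)) y
  inS*⇒unitSquareMultiple (y≢0 , x , x²≡y) =
    square⇒unitSquareMultiple (toℕ x) (y≢0 ∘ ≈⇒≡[mod]) (≡[mod]⇒≈ x²≡y)

  unitSquareMultiple-disjoint : ∀ {k k′ n y} → k < k′ → 2 * k < n →
    UnitSquareMultiple n (p ^ (2 * k)) y → ¬ UnitSquareMultiple n (p ^ (2 * k′)) y
  unitSquareMultiple-disjoint {k} k<k′ 2k<n (w , p∤w , e) (w′ , _ , e′) =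
    ≈p^i*⇒p^[1+i]∤ 2k<n (∤⇒∤² p∤w) (≈-trans e (≈-sym e′))
      (∣-trans (p^-mono-∣ (*-monoʳ-< 2 k<k′)) (m∣m*n (w′ * w′)))

  unitSquareMultiple-unique : ∀ {k k′ n y} → 2 * k < n → 2 * k′ < n →
    UnitSquareMultiple n (p ^ (2 * k)) y → UnitSquareMultiple n (p ^ (2 * k′)) y → k ≡ k′
  unitSquareMultiple-unique {k} {k′} 2k<n 2k′<n s s′ with <-cmp k k′
  ... | tri< k<k′ _ _ = contradiction s′ (unitSquareMultiple-disjoint k<k′ 2k<n s)
  ... | tri≈ _ k≡k′ _ = k≡k′
  ... | tri> _ _ k′<k = contradiction s (unitSquareMultiple-disjoint k′<k 2k′<n s′)

  ∣p^jU²∣≡∣U²∣ : ∀ {j r} → j < r → ∣aU²∣ (p ^ j) (p ^ r) ≡ ∣U²∣ (p ^ (r ∸ j))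
  ∣p^jU²∣≡∣U²∣ {j} {r} j<r = begin
    ∣aU²∣ (p ^ j) (p ^ r)               ≡⟨ ∣aU²∣≡∑< (p ^ j) (p ^ r) ⟩
    ∑< f (p ^ r)                        ≡⟨ cong (∑< f) (p^-split (<⇒≤ j<r)) ⟩
    ∑< f (p ^ j * N)                    ≡⟨ ∑<-multiples (p ^ j) {{m^n≢0 p j}} f N f-vanishes ⟩
    ∑< (λ z → f (p ^ j * z)) N          ≡⟨ ∑<-cong N (λ z _ → iverson-cong _ _ (in-p^jU²⇔inU² z)) ⟩
    ∑< (λ z → iverson (inU²?′ N z)) N   ≡⟨ ∣U²∣≡∑< N ⟨
    ∣U²∣ N                              ∎
    where
    open ≡-Reasoning
    N : ℕ
    N = p ^ (r ∸ j)
    f : ℕ → ℕ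
    f y = iverson (inAU²?′ (p ^ r) (p ^ j) y)
    0<r : 0 < r
    0<r = ≤-trans z<s j<r
    f-vanishes : ∀ y → ¬ p ^ j ∣ y → f y ≡ 0
    f-vanishes y p^j∤y = iverson-no (inAU²?′ (p ^ r) (p ^ j) y) (λ y∈p^jU² →
      p^j∤y (unitSquareMultiple-p^⇒∣ (<⇒≤ j<r)
               (Equivalence.to (inAU²⇔unitSquareMultiple (p ^ j) 0<r) y∈p^jU²)))
    in-p^jU²⇔inU² : ∀ z → InAU²′ (p ^ r) (p ^ j) (p ^ j * z) ⇔ InU²′ N z
    in-p^jU²⇔inU² z = ⇔-trans (inAU²⇔unitSquareMultiple (p ^ j) 0<r)
                        (⇔-trans (unitSquareMultiple-p^⇔ (<⇒≤ j<r))
                                 (⇔-sym (inU²⇔unitSquare (m<n⇒0<n∸m j<r))))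

  ∣S*∣≡∑∣p^2kU²∣ : ∀ {r} → 0 < r →
                   ∣S*∣ (p ^ r) ≡ ∑< (λ k → ∣aU²∣ (p ^ (2 * k)) (p ^ r)) (suc ((r ∸ 1) / 2))
  ∣S*∣≡∑∣p^2kU²∣ {r} 0<r = begin
    ∣S*∣ M                                    ≡⟨ ∣S*∣≡∑< M ⟩
    ∑< (λ y → iverson (inS*?′ M y)) M         ≡⟨ ∑<-cong M (λ y _ → iverson-inS*≡∑ y) ⟩
    ∑< (λ y → ∑< (λ k → [ y ∈p^2kU²] k) K) M  ≡⟨ ∑<-comm (λ y k → [ y ∈p^2kU²] k) M K ⟩
    ∑< (λ k → ∑< (λ y → [ y ∈p^2kU²] k) M) K  ≡⟨ ∑<-cong K (λ k _ → ∣aU²∣≡∑< (p ^ (2 * k)) M) ⟨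
    ∑< (λ k → ∣aU²∣ (p ^ (2 * k)) M) K        ∎
    where
    open ≡-Reasoning
    M K : ℕ
    M = p ^ r
    K = suc ((r ∸ 1) / 2)
    [_∈p^2kU²] : ℕ → ℕ → ℕ
    [ y ∈p^2kU²] k = iverson (inAU²?′ M (p ^ (2 * k)) y)
    k<K⇒2k<r : ∀ {k} → k < K → 2 * k < r
    k<K⇒2k<r k<K = k≤[r∸1]/2⇒2*k<r 0<r (s≤s⁻¹ k<K)
    iverson-inS*≡∑ : ∀ y → iverson (inS*?′ M y) ≡ ∑< [ y ∈p^2kU²] K
    iverson-inS*≡∑ y with inS*?′ M y
    ... | yes y∈S* with inS*⇒unitSquareMultiple y∈S*
    ...   | k , 2k<r , s = sym (∑<-iverson-unique (λ k → inAU²?′ M (p ^ (2 * k)) y) K k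
              (s≤s (2*k<r⇒k≤[r∸1]/2 2k<r)) (Equivalence.from (inAU²⇔unitSquareMultiple (p ^ (2 * k)) 0<r) s)
              (λ k′ k′<K s′ → unitSquareMultiple-unique {k′} {k} (k<K⇒2k<r k′<K) 2k<r
                                (Equivalence.to (inAU²⇔unitSquareMultiple (p ^ (2 * k′)) 0<r) s′) s))
    iverson-inS*≡∑ y | no y∉S* = sym (∑<-zero K (λ k k<K → iverson-no (inAU²?′ M (p ^ (2 * k)) y)
      (λ s → y∉S* (unitSquareMultiple⇒inS* {k} (k<K⇒2k<r k<K)
                     (Equivalence.to (inAU²⇔unitSquareMultiple (p ^ (2 * k)) 0<r) s)))))

  ∑∣p^2kU²∣≡∑∣U²∣ : ∀ {r} → 0 < r →
    ∑< (λ k → ∣aU²∣ (p ^ (2 * k)) (p ^ r)) (suc ((r ∸ 1) / 2))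
      ≡ ∑< (λ k → ∣U²∣ (p ^ (r ∸ 2 * k))) (suc ((r ∸ 1) / 2))
  ∑∣p^2kU²∣≡∑∣U²∣ 0<r = ∑<-cong _ (λ k k<K → ∣p^jU²∣≡∣U²∣ (k≤[r∸1]/2⇒2*k<r 0<r (s≤s⁻¹ k<K)))

  ∣S*∣≡∑∣U²∣ : ∀ {r} → 0 < r →
               ∣S*∣ (p ^ r) ≡ ∑< (λ k → ∣U²∣ (p ^ (r ∸ 2 * k))) (suc ((r ∸ 1) / 2))
  ∣S*∣≡∑∣U²∣ 0<r = trans (∣S*∣≡∑∣p^2kU²∣ 0<r) (∑∣p^2kU²∣≡∑∣U²∣ 0<r)

  ∣S*[p^2t]∣ : ∀ t → 0 < 2 * t → ∣S*∣ (p ^ (2 * t)) ≡ ∑< (λ i → ∣U²∣ (p ^ (2 * suc i))) t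
  ∣S*[p^2t]∣ t@(suc t′) 0<2t = begin
    ∣S*∣ (p ^ (2 * t))                   ≡⟨ ∣S*∣≡∑∣U²∣ 0<2t ⟩
    ∑< g (suc ((2 * t ∸ 1) / 2))         ≡⟨ cong (λ K → ∑< g (suc K)) [2t∸1]/2≡t′ ⟩
    ∑< g t                               ≡⟨ ∑<-reverse g t ⟩
    ∑< (λ i → g (t ∸ suc i)) t
      ≡⟨ ∑<-cong t (λ i i<t → cong (∣U²∣ ∘ (p ^_)) (2*t∸2*[t∸j]≡2*j i<t)) ⟩
    ∑< (λ i → ∣U²∣ (p ^ (2 * suc i))) t  ∎
    where
    open ≡-Reasoning
    g : ℕ → ℕ
    g k = ∣U²∣ (p ^ (2 * t ∸ 2 * k))
    [2t∸1]/2≡t′ : (2 * t ∸ 1) / 2 ≡ t′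
    [2t∸1]/2≡t′ = trans (cong (λ x → (x ∸ 1) / 2) (*-suc 2 t′))
                        (trans (cong (_/ 2) (+-comm 1 (2 * t′))) ([2*t+1]/2≡t t′))

  ∣S*[p^2t+1]∣ : ∀ t → ∣S*∣ (p ^ (2 * t + 1)) ≡ ∑< (λ i → ∣U²∣ (p ^ (2 * i + 1))) (suc t)
  ∣S*[p^2t+1]∣ t = begin
    ∣S*∣ (p ^ (2 * t + 1))                     ≡⟨ ∣S*∣≡∑∣U²∣ (subst (0 <_) (+-comm 1 (2 * t)) z<s) ⟩
    ∑< g (suc ((2 * t + 1 ∸ 1) / 2))           ≡⟨ cong (λ K → ∑< g (suc K)) [2t+1∸1]/2≡t ⟩
    ∑< g (suc t)                               ≡⟨ ∑<-reverse g (suc t) ⟩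
    ∑< (λ i → g (t ∸ i)) (suc t)
      ≡⟨ ∑<-cong (suc t) (λ i i≤t → cong (∣U²∣ ∘ (p ^_)) (exponent (s≤s⁻¹ i≤t))) ⟩
    ∑< (λ i → ∣U²∣ (p ^ (2 * i + 1))) (suc t)  ∎
    where
    open ≡-Reasoning
    g : ℕ → ℕ
    g k = ∣U²∣ (p ^ (2 * t + 1 ∸ 2 * k))
    [2t+1∸1]/2≡t : (2 * t + 1 ∸ 1) / 2 ≡ t
    [2t+1∸1]/2≡t = trans (cong (_/ 2) (m+n∸n≡m (2 * t) 1)) (2*t/2≡t t)
    exponent : ∀ {i} → i ≤ t → 2 * t + 1 ∸ 2 * (t ∸ i) ≡ 2 * i + 1
    exponent {i} i≤t = trans (+-∸-comm 1 (*-monoʳ-≤ 2 (m∸n≤m t i))) (cong (_+ 1) (2*t∸2*[t∸j]≡2*j i≤t))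

theorem1 : (p r : ℕ) → Prime p → r ≥ 1 →
    ((∣S*∣ (p ^ r) ≡ ∑≤ ((r ∸ 1) / 2) (λ k → ∣aU²∣ (p ^ (2 * k)) (p ^ r)))
    × (∑≤ ((r ∸ 1) / 2) (λ k → ∣aU²∣ (p ^ (2 * k)) (p ^ r))
        ≡ ∑≤ ((r ∸ 1) / 2) (λ k → ∣U²∣ (p ^ (r ∸ 2 * k)))))
    × ((∀ t → r ≡ 2 * t → ∣S*∣ (p ^ r) ≡ ∑from-to 1 t (λ l → ∣U²∣ (p ^ (2 * l))))
    × (∀ t → r ≡ 2 * t + 1 → ∣S*∣ (p ^ r) ≡ ∑from-to 0 t (λ l → ∣U²∣ (p ^ (2 * l + 1)))))
theorem1 p r p-prime 0<r =
  ( trans (∣S*∣≡∑∣p^2kU²∣ p-prime 0<r) (sym (sum-map-upTo _ K))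
  , trans (sum-map-upTo _ K) (trans (∑∣p^2kU²∣≡∑∣U²∣ p-prime 0<r) (sym (sum-map-upTo _ K))) )
  , (λ { t refl → trans (∣S*[p^2t]∣ p-prime t 0<r) (sym (sum-map-upTo _ t)) })
  , (λ { t refl → trans (∣S*[p^2t+1]∣ p-prime t) (sym (sum-map-upTo _ (suc t))) })
  where K = suc ((r ∸ 1) / 2)
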